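{- Let $n \ge 1$ and let $k, \ell$ be nonnegative integers. The number of pairs $(T,v)$ with $T \in \mathcal{T}_n$ and $v$ a vertex of $T$ of outdegree exactly $k$ at level exactly $\ell$ equals $$\frac{k+2\ell}{2n-k}\binom{2n-k}{n+\ell}.$$
   Context: $\mathcal{T}_n$ denotes the set of rooted ordered (plane) trees with $n$ edges. The outdegree of a vertex is its number of children; the level of a vertex is its distance (number of edges) from the root. -}

module Defs where

open import Data.Nat using (ℕ; zero; suc; _+_)
open import Data.List using (List; []; _∷_; length; lookup)
open import Data.Fin using (Fin)
open import Data.Product using (Σ; _×_)
open import Relation.Binary.PropositionalEquality using (_≡_)

data Tree : Set where
  node : List Tree → Tree

mutual
  edges : Tree → ℕ
  edges (node ts) = edgesL ts

  edgesL : List Tree → ℕ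
  edgesL []       = 0
  edgesL (t ∷ ts) = suc (edges t) + edgesL ts

𝒯 : ℕ → Set
𝒯 n = Σ Tree (λ t → edges t ≡ n)

data Vertex : Tree → Set where
  root  : ∀ {ts} → Vertex (node ts)
  child : ∀ {ts} (i : Fin (length ts)) → Vertex (lookup ts i) → Vertex (node ts)

outdeg : ∀ {t} → Vertex t → ℕ
outdeg {node ts} root = length ts
outdeg (child i v)    = outdeg v

level : ∀ {t} → Vertex t → ℕ
level root        = 0
level (child i v) = suc (level v)

Pairs : ℕ → ℕ → ℕ → Set
Pairs n k ℓ = Σ (𝒯 n) (λ T → Σ (Vertex (Σ.proj₁ T)) (λ v → outdeg v ≡ k × level v ≡ ℓ))

-- Walking from the root down to v, record at each step the siblings to the left and to the
-- right of the path, each hung under a fresh root; after ℓ steps append the k subtrees of v.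
-- This is a bijection between pairs (T , v) and forests of k + 2ℓ plane trees with n − ℓ − k
-- edges in total.  Deleting the first edge of the first tree (a leaf tree disappears, otherwise
-- its first subtree becomes a separate tree) gives the ballot recurrence for the number of
-- forests with r trees and m edges, whose solution C(2m+r−1, m) − C(2m+r−1, m−1) equals
-- r/(2m+r) · C(2m+r, m); with r = k + 2ℓ and m = n − ℓ − k this is the stated formula.

module Submission where

open import Defs
open import Data.Nat using (ℕ; zero; suc; _+_; _*_; _∸_; _≤_; _<_; z≤n; s≤s; _≤?_; NonZero; >-nonZero)
open import Data.Nat.Properties
open import Data.Nat.Combinatorics using (_C_; nCk+nC[k+1]≡[n+1]C[k+1]; nCk≡nC[n∸k]; nC1≡n; k>n⇒nCk≡0)
open import Data.Nat.Tactic.RingSolver using (solve-∀)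
open import Data.List using (List; []; _∷_; length; lookup)
open import Data.Fin using (Fin; zero; suc)
open import Data.Fin.Properties using (+↔⊎)
open import Data.Product using (Σ; _×_; _,_; proj₁; proj₂)
open import Data.Sum using (_⊎_; inj₁; inj₂)
open import Data.Sum.Function.Propositional using (_⊎-↔_)
open import Data.Empty using (⊥-elim)
open import Function.Bundles using (_↔_; mk↔ₛ′)
open import Function.Properties.Inverse using (↔-sym; ↔-trans)
open import Relation.Nullary using (¬_; yes; no)
open import Relation.Binary.PropositionalEquality

Pointed : Set
Pointed = Σ Tree Vertex

PointedForest : Set
PointedForest = Σ (List Tree) λ ts → Σ (Fin (length ts)) λ i → Vertex (lookup ts i)

plant : PointedForest → Pointed
plant (ts , i , v) = node ts , child i v

before after : (ts : List Tree) → Fin (length ts) → List Tree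
before (t ∷ ts) zero    = []
before (t ∷ ts) (suc i) = t ∷ before ts i
after  (t ∷ ts) zero    = ts
after  (t ∷ ts) (suc i) = after ts i

split : PointedForest → List Tree × Pointed × List Tree
split (ts , i , v) = before ts i , (lookup ts i , v) , after ts i

prepend : Tree → PointedForest → PointedForest
prepend t (ts , i , v) = t ∷ ts , suc i , v

insert : List Tree → Pointed → List Tree → PointedForest
insert []      (s , v) R = s ∷ R , zero , v
insert (t ∷ L) p       R = prepend t (insert L p R)

insert-split : ∀ ts i v → insert (before ts i) (lookup ts i , v) (after ts i) ≡ (ts , i , v)
insert-split (t ∷ ts) zero    v = refl
insert-split (t ∷ ts) (suc i) v = cong (prepend t) (insert-split ts i v)

split-insert : ∀ L p R → split (insert L p R) ≡ (L , p , R)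
split-insert []      p R = refl
split-insert (t ∷ L) p R = cong (λ (L′ , p′ , R′) → t ∷ L′ , p′ , R′) (split-insert L p R)

encode : ∀ {t} → Vertex t → List Tree
encode {node ts} root        = ts
encode {node ts} (child i v) = node (before ts i) ∷ node (after ts i) ∷ encode v

decode : ℕ → List Tree → Pointed
decode zero    ts                       = node ts , root
decode (suc ℓ) (node L ∷ node R ∷ ts) = plant (insert L (decode ℓ ts) R)
decode (suc ℓ) _                        = node [] , root   -- junk: fewer than 2 trees

decode-encode : ∀ {t} (v : Vertex t) → decode (level v) (encode v) ≡ (t , v)
decode-encode root = refl
decode-encode {node ts} (child i v) = begin
  plant (insert (before ts i) (decode (level v) (encode v)) (after ts i))
    ≡⟨ cong (λ p → plant (insert (before ts i) p (after ts i))) (decode-encode v) ⟩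
  plant (insert (before ts i) (lookup ts i , v) (after ts i))
    ≡⟨ cong plant (insert-split ts i v) ⟩
  (node ts , child i v) ∎
  where open ≡-Reasoning

decode-section : ∀ {k} ℓ ts → length ts ≡ 2 * ℓ + k →
  encode (proj₂ (decode ℓ ts)) ≡ ts × level (proj₂ (decode ℓ ts)) ≡ ℓ
decode-section         zero    ts _      = refl , refl
decode-section {k = k} (suc ℓ) ts length≡ = go ts (trans length≡ (cong (_+ k) (*-suc 2 ℓ)))
  where
  go : ∀ ts → length ts ≡ 2 + 2 * ℓ + k →
    encode (proj₂ (decode (suc ℓ) ts)) ≡ ts × level (proj₂ (decode (suc ℓ) ts)) ≡ suc ℓ
  go (node L ∷ node R ∷ ts) length≡ =
    trans (cong (λ (L′ , p′ , R′) → node L′ ∷ node R′ ∷ encode (proj₂ p′)) split≡)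
          (cong (λ us → node L ∷ node R ∷ us) (proj₁ ih)) ,
    trans (cong (λ (_ , p′ , _) → suc (level (proj₂ p′))) split≡) (cong suc (proj₂ ih))
    where
    ih : encode (proj₂ (decode ℓ ts)) ≡ ts × level (proj₂ (decode ℓ ts)) ≡ ℓ
    ih = decode-section ℓ ts (suc-injective (suc-injective length≡))
    split≡ : split (insert L (decode ℓ ts) R) ≡ (L , decode ℓ ts , R)
    split≡ = split-insert L (decode ℓ ts) R

length-encode : ∀ {t} (v : Vertex t) → length (encode v) ≡ 2 * level v + outdeg v
length-encode root        = refl
length-encode (child i v) =
  trans (cong (2 +_) (length-encode v)) (sym (cong (_+ outdeg v) (*-suc 2 (level v))))

edgesL-split : ∀ ts i →
  edgesL ts ≡ edgesL (before ts i) + (suc (edges (lookup ts i)) + edgesL (after ts i))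
edgesL-split (t ∷ ts) zero    = refl
edgesL-split (t ∷ ts) (suc i) =
  trans (cong (suc (edges t) +_) (edgesL-split ts i)) (sym (+-assoc (suc (edges t)) _ _))

edges-encode : ∀ {t} (v : Vertex t) → edgesL (encode v) ≡ edges t + level v
edges-encode {node ts} root        = sym (+-identityʳ (edgesL ts))
edges-encode {node ts} (child i v) = begin
  suc (edgesL (before ts i)) + (suc (edgesL (after ts i)) + edgesL (encode v))
    ≡⟨ cong (λ e → suc (edgesL (before ts i)) + (suc (edgesL (after ts i)) + e)) (edges-encode v) ⟩
  suc (edgesL (before ts i)) + (suc (edgesL (after ts i)) + (edges (lookup ts i) + level v))
    ≡⟨ rearrange (edgesL (before ts i)) (edgesL (after ts i)) (edges (lookup ts i)) (level v) ⟩
  edgesL (before ts i) + (suc (edges (lookup ts i)) + edgesL (after ts i)) + suc (level v)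
    ≡⟨ cong (_+ suc (level v)) (edgesL-split ts i) ⟨
  edgesL ts + suc (level v) ∎
  where
  open ≡-Reasoning
  rearrange : ∀ b a s l → suc b + (suc a + (s + l)) ≡ b + (suc s + a) + suc l
  rearrange = solve-∀

-- edgesL ts counts one edge per tree besides the edges of the trees: Forest r (r + m) has m edges.
Forest : ℕ → ℕ → Set
Forest r e = Σ (List Tree) λ ts → length ts ≡ r × edgesL ts ≡ e

Forest-≡ : ∀ {r e} (x y : Forest r e) → proj₁ x ≡ proj₁ y → x ≡ y
Forest-≡ (ts , l , e) (.ts , l′ , e′) refl =
  cong₂ (λ p q → ts , p , q) (≡-irrelevant l l′) (≡-irrelevant e e′)

Pairs-≡ : ∀ {n k ℓ} (x y : Pairs n k ℓ) →
  (proj₁ (proj₁ x) , proj₁ (proj₂ x)) ≡ (proj₁ (proj₁ y) , proj₁ (proj₂ y)) → x ≡ y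
Pairs-≡ ((t , e) , v , o , l) ((.t , e′) , .v , o′ , l′) refl
  rewrite ≡-irrelevant e e′ | ≡-irrelevant o o′ | ≡-irrelevant l l′ = refl

toForest : ∀ {n k ℓ} → Pairs n k ℓ → Forest (2 * ℓ + k) (n + ℓ)
toForest ((t , edges≡) , v , outdeg≡ , level≡) =
  encode v ,
  trans (length-encode v) (cong₂ (λ l d → 2 * l + d) level≡ outdeg≡) ,
  trans (edges-encode v) (cong₂ _+_ edges≡ level≡)

fromForest : ∀ {n k ℓ} → Forest (2 * ℓ + k) (n + ℓ) → Pairs n k ℓ
fromForest {n} {k} {ℓ} (ts , length≡ , edges≡) = (t , edges-t) , v , outdeg-v , level-v
  where
  open ≡-Reasoning
  t : Tree
  t = proj₁ (decode ℓ ts)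
  v : Vertex t
  v = proj₂ (decode ℓ ts)
  section : encode v ≡ ts × level v ≡ ℓ
  section = decode-section ℓ ts length≡
  level-v : level v ≡ ℓ
  level-v = proj₂ section
  edges-t : edges t ≡ n
  edges-t = +-cancelʳ-≡ ℓ (edges t) n (begin
    edges t + ℓ         ≡⟨ cong (edges t +_) level-v ⟨
    edges t + level v   ≡⟨ edges-encode v ⟨
    edgesL (encode v)   ≡⟨ cong edgesL (proj₁ section) ⟩
    edgesL ts           ≡⟨ edges≡ ⟩
    n + ℓ               ∎)
  outdeg-v : outdeg v ≡ k
  outdeg-v = +-cancelˡ-≡ (2 * ℓ) (outdeg v) k (begin
    2 * ℓ + outdeg v       ≡⟨ cong (λ l → 2 * l + outdeg v) level-v ⟨
    2 * level v + outdeg v ≡⟨ length-encode v ⟨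
    length (encode v)      ≡⟨ cong length (proj₁ section) ⟩
    length ts              ≡⟨ length≡ ⟩
    2 * ℓ + k              ∎)

Pairs↔Forest : ∀ {n k ℓ} → Pairs n k ℓ ↔ Forest (2 * ℓ + k) (n + ℓ)
Pairs↔Forest {ℓ = ℓ} = mk↔ₛ′ toForest fromForest
  (λ x@(ts , length≡ , _) → Forest-≡ _ x (proj₁ (decode-section ℓ ts length≡)))
  (λ x@((t , _) , v , _ , level≡) → Pairs-≡ _ x
      (subst (λ j → decode j (encode v) ≡ (t , v)) level≡ (decode-encode v)))

length≤edgesL : ∀ ts → length ts ≤ edgesL ts
length≤edgesL []       = z≤n
length≤edgesL (t ∷ ts) = s≤s (≤-trans (length≤edgesL ts) (m≤n+m _ (edges t)))

Forest-empty : ∀ {r e} → e < r → ¬ Forest r e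
Forest-empty e<r (ts , refl , refl) = <⇒≱ e<r (length≤edgesL ts)

Fin0↔Empty : ∀ {A : Set} → ¬ A → Fin 0 ↔ A
Fin0↔Empty ¬a = mk↔ₛ′ (λ ()) (λ a → ⊥-elim (¬a a)) (λ a → ⊥-elim (¬a a)) (λ ())

Forest-uncons↔ : ∀ {r e} → (Forest r e ⊎ Forest (suc (suc r)) (suc e)) ↔ Forest (suc r) (suc e)
Forest-uncons↔ {r} {e} = mk↔ₛ′ to from
  (λ { x@(node []      ∷ _ , _) → Forest-≡ _ x refl
     ; x@(node (_ ∷ _) ∷ _ , _) → Forest-≡ _ x refl })
  (λ { (inj₁ x)                  → cong inj₁ (Forest-≡ _ x refl)
     ; (inj₂ x@(_ ∷ node _ ∷ _ , _)) → cong inj₂ (Forest-≡ _ x refl) })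
  where
  regroup : ∀ a b c → suc (suc a + b) + c ≡ suc a + (suc b + c)
  regroup = solve-∀
  to : Forest r e ⊎ Forest (suc (suc r)) (suc e) → Forest (suc r) (suc e)
  to (inj₁ (ts , length≡ , edges≡)) = node [] ∷ ts , cong suc length≡ , cong suc edges≡
  to (inj₂ (u ∷ node us ∷ ts , length≡ , edges≡)) =
    node (u ∷ us) ∷ ts , suc-injective length≡ ,
    trans (regroup (edges u) (edgesL us) (edgesL ts)) edges≡
  from : Forest (suc r) (suc e) → Forest r e ⊎ Forest (suc (suc r)) (suc e)
  from (node [] ∷ ts , length≡ , edges≡) = inj₁ (ts , suc-injective length≡ , suc-injective edges≡)
  from (node (u ∷ us) ∷ ts , length≡ , edges≡) =
    inj₂ (u ∷ node us ∷ ts , cong suc length≡ ,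
          trans (sym (regroup (edges u) (edgesL us) (edgesL ts))) edges≡)

forestCount : ℕ → ℕ → ℕ
forestCount zero    zero    = 1
forestCount zero    (suc m) = 0
forestCount (suc r) zero    = forestCount r zero + 0
forestCount (suc r) (suc m) = forestCount r (suc m) + forestCount (suc (suc r)) m

forestCount↔ : ∀ r m → Fin (forestCount r m) ↔ Forest r (r + m)
forestCount↔ zero    zero    =
  mk↔ₛ′ (λ _ → [] , refl , refl) (λ _ → zero) (λ { ([] , refl , refl) → refl }) (λ { zero → refl })
forestCount↔ zero    (suc m) = Fin0↔Empty λ { ([] , _ , ()) }
forestCount↔ (suc r) zero    = ↔-trans +↔⊎ (↔-trans
  (forestCount↔ r zero ⊎-↔ Fin0↔Empty (Forest-empty (s≤s (s≤s (≤-reflexive (+-identityʳ r))))))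
  Forest-uncons↔)
forestCount↔ (suc r) (suc m) = ↔-trans +↔⊎ (↔-trans
  (forestCount↔ r (suc m) ⊎-↔
    subst (λ e → Fin (forestCount (suc (suc r)) m) ↔ Forest (suc (suc r)) e)
          (cong suc (sym (+-suc r m))) (forestCount↔ (suc (suc r)) m))
  Forest-uncons↔)

[k+1]*[n+1]C[k+1]≡[n+1]*nCk : ∀ n k → suc k * (suc n C suc k) ≡ suc n * (n C k)
[k+1]*[n+1]C[k+1]≡[n+1]*nCk zero    zero    = refl
[k+1]*[n+1]C[k+1]≡[n+1]*nCk zero    (suc k) =
  *-zeroʳ (suc (suc k))
[k+1]*[n+1]C[k+1]≡[n+1]*nCk (suc n) zero    =
  trans (*-identityˡ _) (trans (nC1≡n (suc (suc n))) (sym (*-identityʳ (suc (suc n)))))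
[k+1]*[n+1]C[k+1]≡[n+1]*nCk (suc n) (suc k) = begin
  suc (suc k) * (suc N C suc (suc k))
    ≡⟨ cong (suc (suc k) *_) (nCk+nC[k+1]≡[n+1]C[k+1] N (suc k)) ⟨
  suc (suc k) * (N C suc k + N C suc (suc k))
    ≡⟨ *-distribˡ-+ (suc (suc k)) (N C suc k) _ ⟩
  N C suc k + suc k * (N C suc k) + suc (suc k) * (N C suc (suc k))
    ≡⟨ cong₂ (λ x y → N C suc k + x + y)
             ([k+1]*[n+1]C[k+1]≡[n+1]*nCk n k) ([k+1]*[n+1]C[k+1]≡[n+1]*nCk n (suc k)) ⟩
  N C suc k + N * (n C k) + N * (n C suc k)
    ≡⟨ +-assoc (N C suc k) _ _ ⟩
  N C suc k + (N * (n C k) + N * (n C suc k))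
    ≡⟨ cong (N C suc k +_) (*-distribˡ-+ N (n C k) _) ⟨
  N C suc k + N * (n C k + n C suc k)
    ≡⟨ cong (λ x → N C suc k + N * x) (nCk+nC[k+1]≡[n+1]C[k+1] n k) ⟩
  suc N * (N C suc k) ∎
  where
  open ≡-Reasoning
  N : ℕ
  N = suc n

[n+1]*nCk+k*[n+1]Ck≡[n+1]*[n+1]Ck : ∀ n k → suc n * (n C k) + k * (suc n C k) ≡ suc n * (suc n C k)
[n+1]*nCk+k*[n+1]Ck≡[n+1]*[n+1]Ck n zero    = +-identityʳ (suc n * 1)
[n+1]*nCk+k*[n+1]Ck≡[n+1]*[n+1]Ck n (suc k) = begin
  suc n * (n C suc k) + suc k * (suc n C suc k)
    ≡⟨ cong (suc n * (n C suc k) +_) ([k+1]*[n+1]C[k+1]≡[n+1]*nCk n k) ⟩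
  suc n * (n C suc k) + suc n * (n C k)
    ≡⟨ +-comm (suc n * (n C suc k)) _ ⟩
  suc n * (n C k) + suc n * (n C suc k)
    ≡⟨ *-distribˡ-+ (suc n) (n C k) _ ⟨
  suc n * (n C k + n C suc k)
    ≡⟨ cong (suc n *_) (nCk+nC[k+1]≡[n+1]C[k+1] n k) ⟩
  suc n * (suc n C suc k) ∎
  where open ≡-Reasoning

[m+n]Cm≡[m+n]Cn : ∀ m n → (m + n) C m ≡ (m + n) C n
[m+n]Cm≡[m+n]Cn m n = trans (nCk≡nC[n∸k] (m≤m+n m n)) (cong ((m + n) C_) (m+n∸m≡n m n))

forestCount-zero : ∀ r → forestCount r zero ≡ 1
forestCount-zero zero    = refl
forestCount-zero (suc r) = trans (+-identityʳ _) (forestCount-zero r)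

+-telescope : ∀ {a b w x y} → a + x ≡ y → b + w ≡ x → a + b + (w + x) ≡ x + y
+-telescope {a} {b} {w} {x} {y} a+x≡y b+w≡x =
  trans (interchange a b w x) (trans (cong₂ _+_ a+x≡y b+w≡x) (+-comm y x))
  where
  interchange : ∀ a b w x → a + b + (w + x) ≡ a + x + (b + w)
  interchange = solve-∀

-- forestCount (r + 1) (m + 1) = C(P, m + 1) − C(P, m) where P = r + 2m + 2; under the
-- recurrence of forestCount the right-hand sides telescope.
forestCount-ballot : ∀ r m →
  forestCount (suc r) (suc m) + (r + suc m + suc m) C m ≡ (r + suc m + suc m) C suc m
forestCount-ballot zero    zero    = refl
forestCount-ballot zero    (suc m) =
  subst (λ N → forestCount 2 (suc m) + N C suc m ≡ N C suc (suc m))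
        (cong suc (sym (+-suc (suc m) (suc m))))
  (begin
    forestCount 2 (suc m) + suc Q C suc m
      ≡⟨ cong (forestCount 2 (suc m) +_) (nCk+nC[k+1]≡[n+1]C[k+1] Q m) ⟨
    forestCount 2 (suc m) + (Q C m + Q C suc m)
      ≡⟨ +-assoc (forestCount 2 (suc m)) _ _ ⟨
    forestCount 2 (suc m) + Q C m + Q C suc m
      ≡⟨ cong (_+ Q C suc m) (forestCount-ballot 1 m) ⟩
    Q C suc m + Q C suc m
      ≡⟨ cong (Q C suc m +_) ([m+n]Cm≡[m+n]Cn (suc (suc m)) (suc m)) ⟨
    Q C suc m + Q C suc (suc m)
      ≡⟨ nCk+nC[k+1]≡[n+1]C[k+1] Q (suc m) ⟩
    suc Q C suc (suc m) ∎)
  where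
  open ≡-Reasoning
  Q : ℕ
  Q = suc (suc m + suc m)
forestCount-ballot (suc r) zero    =
  trans (+-telescope (forestCount-ballot r zero) (trans (+-identityʳ _) (forestCount-zero (3 + r))))
        (nCk+nC[k+1]≡[n+1]C[k+1] (r + 1 + 1) zero)
forestCount-ballot (suc r) (suc m) =
  trans (cong (forestCount (suc r) (suc (suc m)) + forestCount (3 + r) (suc m) +_)
              (sym (nCk+nC[k+1]≡[n+1]C[k+1] P m)))
  (trans (+-telescope (forestCount-ballot r (suc m))
                    (subst (λ N → forestCount (3 + r) (suc m) + N C m ≡ N C suc m) (top-shift r m)
                           (forestCount-ballot (suc (suc r)) m)))
         (nCk+nC[k+1]≡[n+1]C[k+1] P (suc m)))
  where
  P : ℕ
  P = r + suc (suc m) + suc (suc m)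
  top-shift : ∀ r m → suc (suc r) + suc m + suc m ≡ r + suc (suc m) + suc (suc m)
  top-shift = solve-∀

forestCount-closedForm : ∀ r m → forestCount r m * (r + m + m) ≡ r * ((r + m + m) C m)
forestCount-closedForm zero    zero    = refl
forestCount-closedForm zero    (suc m) = refl
forestCount-closedForm (suc r) zero    = begin
  forestCount (suc r) 0 * (suc r + 0 + 0) ≡⟨ cong (_* (suc r + 0 + 0)) (forestCount-zero (suc r)) ⟩
  1 * (suc r + 0 + 0)                     ≡⟨ unit (suc r) ⟩
  suc r * 1                               ∎
  where
  open ≡-Reasoning
  unit : ∀ x → 1 * (x + 0 + 0) ≡ x * 1
  unit = solve-∀
forestCount-closedForm (suc r) (suc m) =
  +-cancelʳ-≡ (suc m * c) _ _ (+-cancelʳ-≡ (suc m * c) _ _ (begin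
    G * suc P + suc m * c + suc m * c
      ≡⟨ cong (λ x → G * suc P + x + suc m * c) ([k+1]*[n+1]C[k+1]≡[n+1]*nCk P m) ⟩
    G * suc P + suc P * (P C m) + suc m * c
      ≡⟨ cong (λ x → x + suc P * (P C m) + suc m * c) (*-comm G (suc P)) ⟩
    suc P * G + suc P * (P C m) + suc m * c
      ≡⟨ cong (_+ suc m * c) (*-distribˡ-+ (suc P) G (P C m)) ⟨
    suc P * (G + P C m) + suc m * c
      ≡⟨ cong (λ x → suc P * x + suc m * c) (forestCount-ballot r m) ⟩
    suc P * (P C suc m) + suc m * c
      ≡⟨ [n+1]*nCk+k*[n+1]Ck≡[n+1]*[n+1]Ck P (suc m) ⟩
    (suc r + suc m + suc m) * c
      ≡⟨ *-distribʳ-+ c (suc r + suc m) (suc m) ⟩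
    (suc r + suc m) * c + suc m * c
      ≡⟨ cong (_+ suc m * c) (*-distribʳ-+ c (suc r) (suc m)) ⟩
    suc r * c + suc m * c + suc m * c ∎))
  where
  open ≡-Reasoning
  G P c : ℕ
  G = forestCount (suc r) (suc m)
  P = r + suc m + suc m
  c = suc P C suc m

Pairs-empty : ∀ {n k ℓ} → n < ℓ + k → ¬ Pairs n k ℓ
Pairs-empty {n} {k} {ℓ} n<ℓ+k p =
  Forest-empty (subst (n + ℓ <_) (regroup ℓ k) (+-monoˡ-< ℓ n<ℓ+k)) (toForest p)
  where
  regroup : ∀ ℓ k → ℓ + k + ℓ ≡ 2 * ℓ + k
  regroup = solve-∀

Fin↔Pairs : ∀ ℓ k o → Fin (forestCount (2 * ℓ + k) o) ↔ Pairs (ℓ + k + o) k ℓ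
Fin↔Pairs ℓ k o = ↔-trans
  (subst (λ e → Fin (forestCount (2 * ℓ + k) o) ↔ Forest (2 * ℓ + k) e) (regroup ℓ k o)
         (forestCount↔ (2 * ℓ + k) o))
  (↔-sym Pairs↔Forest)
  where
  regroup : ∀ ℓ k o → 2 * ℓ + k + o ≡ ℓ + k + o + ℓ
  regroup = solve-∀

forestCount-formula : ∀ ℓ k o →
  forestCount (2 * ℓ + k) o * (2 * (ℓ + k + o) ∸ k) ≡
  (k + 2 * ℓ) * ((2 * (ℓ + k + o) ∸ k) C (ℓ + k + o + ℓ))
forestCount-formula ℓ k o = begin
  forestCount r o * (2 * (ℓ + k + o) ∸ k)
    ≡⟨ cong (forestCount r o *_) size≡ ⟩
  forestCount r o * (r + o + o)
    ≡⟨ forestCount-closedForm r o ⟩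
  r * ((r + o + o) C o)
    ≡⟨ cong (r *_) ([m+n]Cm≡[m+n]Cn (r + o) o) ⟨
  r * ((r + o + o) C (r + o))
    ≡⟨ cong₂ _*_ (+-comm (2 * ℓ) k) (cong₂ _C_ (sym size≡) (regroup ℓ k o)) ⟩
  (k + 2 * ℓ) * ((2 * (ℓ + k + o) ∸ k) C (ℓ + k + o + ℓ)) ∎
  where
  open ≡-Reasoning
  r : ℕ
  r = 2 * ℓ + k
  double : ∀ ℓ k o → 2 * (ℓ + k + o) ≡ 2 * ℓ + k + o + o + k
  double = solve-∀
  regroup : ∀ ℓ k o → 2 * ℓ + k + o ≡ ℓ + k + o + ℓ
  regroup = solve-∀
  size≡ : 2 * (ℓ + k + o) ∸ k ≡ r + o + o
  size≡ = trans (cong (_∸ k) (double ℓ k o)) (m+n∸n≡m (r + o + o) k)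

[2n∸k]C[n+ℓ]≡0 : ∀ {n k ℓ} → 1 ≤ n → n < ℓ + k → (2 * n ∸ k) C (n + ℓ) ≡ 0
[2n∸k]C[n+ℓ]≡0 {n} {k} {ℓ} 1≤n n<ℓ+k = k>n⇒nCk≡0 (m<n+o⇒m∸n<o (2 * n) k
  (subst₂ _<_ (sym (cong (n +_) (+-identityʳ n))) (regroup n k ℓ) (+-monoʳ-< n n<ℓ+k)))
  where
  instance
    n+ℓ≢0 : NonZero (n + ℓ)
    n+ℓ≢0 = >-nonZero (≤-trans 1≤n (m≤m+n n ℓ))
  regroup : ∀ n k ℓ → n + (ℓ + k) ≡ k + (n + ℓ)
  regroup = solve-∀

theorem4p2 : (n k ℓ : ℕ) → 1 ≤ n → k < 2 * n →
    Σ ℕ (λ N → (Fin N ↔ Pairs n k ℓ) × N * (2 * n ∸ k) ≡ (k + 2 * ℓ) * ((2 * n ∸ k) C (n + ℓ)))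
theorem4p2 n k ℓ 1≤n _ with ℓ + k ≤? n
... | yes ℓ+k≤n with m≤n⇒∃[o]m+o≡n ℓ+k≤n
...   | o , refl = forestCount (2 * ℓ + k) o , Fin↔Pairs ℓ k o , forestCount-formula ℓ k o
theorem4p2 n k ℓ 1≤n _ | no ℓ+k≰n =
  0 , Fin0↔Empty (Pairs-empty (≰⇒> ℓ+k≰n)) ,
  sym (trans (cong ((k + 2 * ℓ) *_) ([2n∸k]C[n+ℓ]≡0 1≤n (≰⇒> ℓ+k≰n))) (*-zeroʳ (k + 2 * ℓ)))
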